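{- Let $\mathsf{M}$ be a loopless matroid on $[n]$ and $B$ a basis. Then for every $i\ge0$, \[ \binom{\mathrm{ep}(B)}{i}=\big|\{W\subseteq[n]: |W|=|B|+i\text{ and }B\in\mathrm{NBC}(\mathsf{M}|_W)\}\big|. \]
   Context: For a basis $B$ and $x\notin B$, $x$ is externally passive if it is not the smallest element of the unique circuit contained in $B\cup x$; $\mathrm{ep}(B)$ is the number of externally passive elements. $\mathsf{M}|_W$ is the restriction to $W$ (bases: maximal independent subsets of $W$), and $\mathrm{NBC}(\mathsf{N})$ for a matroid $\mathsf{N}$ on an ordered ground set is the set of bases $B$ such that no element $x\notin B$ of the ground set is the minimum of the unique circuit contained in $B\cup x$. -}

module Defs where

open import Level using (0ℓ)
open import Data.Nat using (ℕ; zero; suc; _<_; _+_)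
open import Data.Bool using (true; false)
open import Data.Fin using (Fin; _≤_; _≤?_)
open import Data.Fin.Properties using (any?; all?)
open import Data.Fin.Subset using (Subset; _∈_; _∉_; _⊆_; _⊂_; _∪_; ⁅_⁆; ∣_∣; ⊥; ⊤)
open import Data.Fin.Subset.Properties using (_∈?_; _⊆?_; anySubset?)
open import Data.Vec using (_∷_; [])
open import Data.List using (List; []; _∷_; map; _++_; length; filter; allFin)
open import Data.Product using (Σ; ∃; _×_; _,_; proj₁; proj₂)
open import Relation.Nullary using (¬_; Dec; yes; no; ¬?)
open import Relation.Nullary.Decidable using (_×-dec_)
open import Relation.Unary using (Pred; Decidable)
open import Relation.Binary.PropositionalEquality using (_≡_)

-- Matroids on the ground set [n] = Fin n (naturally ordered), given by
-- their independent sets (decidable, as any predicate on a finite set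
-- can be taken to be).
record Matroid (n : ℕ) : Set₁ where
  field
    Indep   : Pred (Subset n) 0ℓ
    Indep?  : Decidable Indep
    indep-⊥ : Indep ⊥
    indep-⊆ : ∀ {X Y} → X ⊆ Y → Indep Y → Indep X
    augment : ∀ {X Y} → Indep X → Indep Y → ∣ X ∣ < ∣ Y ∣ →
              ∃ λ y → y ∈ Y × y ∉ X × Indep (X ∪ ⁅ y ⁆)

module _ {n : ℕ} (M : Matroid n) where
  open Matroid M

  Loopless : Set
  Loopless = ∀ x → Indep ⁅ x ⁆

  -- Notions for the restriction M|_E (ground set E ⊆ [n], induced order).
  IndepOn : Subset n → Subset n → Set
  IndepOn E X = X ⊆ E × Indep X

  IsBasisOn : Subset n → Subset n → Set
  IsBasisOn E B = IndepOn E B × (∀ B′ → B ⊆ B′ → IndepOn E B′ → B′ ≡ B)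

  IsCircuitOn : Subset n → Subset n → Set
  IsCircuitOn E C = C ⊆ E × ¬ IndepOn E C × (∀ D → D ⊂ C → IndepOn E D)

  IsMinOfCircuitOn : Subset n → Subset n → Fin n → Set
  IsMinOfCircuitOn E B x =
    ∃ λ C → IsCircuitOn E C × C ⊆ (B ∪ ⁅ x ⁆) × x ∈ C × (∀ y → y ∈ C → x ≤ y)

  ExtPassive : Subset n → Fin n → Set
  ExtPassive B x = x ∉ B × ¬ IsMinOfCircuitOn ⊤ B x

  IsNBCOn : Subset n → Subset n → Set
  IsNBCOn E B = IsBasisOn E B × (∀ x → x ∈ E → x ∉ B → ¬ IsMinOfCircuitOn E B x)

  IsBasis : Subset n → Set
  IsBasis = IsBasisOn ⊤

  private
    ⊂? : (p q : Subset n) → Dec (p ⊂ q)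
    ⊂? p q = (p ⊆? q) ×-dec any? (λ x → (x ∈? q) ×-dec ¬? (x ∈? p))

    IndepOn? : ∀ E X → Dec (IndepOn E X)
    IndepOn? E X = (X ⊆? E) ×-dec Indep? X

    allSub? : ∀ E C → Dec (∀ D → D ⊂ C → IndepOn E D)
    allSub? E C with anySubset? (λ D → ⊂? D C ×-dec ¬? (IndepOn? E D))
    ... | yes (D , D⊂C , ¬i) = no λ f → ¬i (f D D⊂C)
    ... | no ¬∃ = yes λ D D⊂C → help D D⊂C (IndepOn? E D)
      where
      help : ∀ D → D ⊂ C → Dec (IndepOn E D) → IndepOn E D
      help D _ (yes i) = i
      help D D⊂C (no ¬i) with ¬∃ (D , D⊂C , ¬i)
      ... | ()

    IsCircuitOn? : ∀ E C → Dec (IsCircuitOn E C)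
    IsCircuitOn? E C = (C ⊆? E) ×-dec (¬? (IndepOn? E C) ×-dec allSub? E C)

  IsMinOfCircuitOn? : ∀ E B x → Dec (IsMinOfCircuitOn E B x)
  IsMinOfCircuitOn? E B x = anySubset? λ C →
    IsCircuitOn? E C ×-dec ((C ⊆? (B ∪ ⁅ x ⁆)) ×-dec ((x ∈? C) ×-dec
      all? (λ y → ¬? (y ∈? C) ⊎→ (x ≤? y))))
    where
    open import Relation.Nullary.Decidable using (_→-dec_)
    _⊎→_ : ∀ {P Q : Set} → Dec (¬ P) → Dec Q → Dec (P → Q)
    _⊎→_ {P} {Q} (yes ¬p) _ = yes λ p → Data.Empty.⊥-elim (¬p p)
      where import Data.Empty
    _⊎→_ (no ¬¬p) (yes q) = yes λ _ → q
    _⊎→_ (no ¬¬p) (no ¬q) = no λ f → ¬¬p λ p → ¬q (f p)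

  ExtPassive? : ∀ B x → Dec (ExtPassive B x)
  ExtPassive? B x = ¬? (x ∈? B) ×-dec ¬? (IsMinOfCircuitOn? ⊤ B x)

  IsNBCOn? : ∀ E B → Dec (IsNBCOn E B)
  IsNBCOn? E B = basis? ×-dec
    all? (λ x → (¬? (x ∈? E) ⊎→ (¬? (¬? (x ∈? B)) ⊎→ ¬? (IsMinOfCircuitOn? E B x))))
    where
    _⊎→_ : ∀ {P Q : Set} → Dec (¬ P) → Dec Q → Dec (P → Q)
    _⊎→_ (yes ¬p) _ = yes λ p → Data.Empty.⊥-elim (¬p p)
      where import Data.Empty
    _⊎→_ (no ¬¬p) (yes q) = yes λ _ → q
    _⊎→_ (no ¬¬p) (no ¬q) = no λ f → ¬¬p λ p → ¬q (f p)
    basis? : Dec (IsBasisOn E B)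
    basis? with IndepOn? E B
    ... | no ¬i = no λ b → ¬i (proj₁ b)
    ... | yes i with anySubset? (λ B′ → (B ⊆? B′) ×-dec (IndepOn? E B′ ×-dec ¬? (B′ ≟ B)))
      where
      open import Data.Vec.Properties using (≡-dec)
      open import Data.Bool.Properties renaming (_≟_ to _≟ᵇ_)
      _≟_ : (p q : Subset n) → Dec (p ≡ q)
      _≟_ = ≡-dec _≟ᵇ_
    ... | yes (B′ , s , j , ne) = no λ b → ne (proj₂ b B′ s j)
    ... | no ¬∃ = yes (i , λ B′ s j → dne (B′ ≟′ B) λ ne → ¬∃ (B′ , s , j , ne))
      where
      open import Data.Vec.Properties using (≡-dec)
      open import Data.Bool.Properties renaming (_≟_ to _≟ᵇ_)
      _≟′_ : (p q : Subset n) → Dec (p ≡ q)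
      _≟′_ = ≡-dec _≟ᵇ_
      dne : ∀ {P : Set} → Dec P → ¬ ¬ P → P
      dne (yes p) _ = p
      dne (no ¬p) ¬¬p with ¬¬p ¬p
      ... | ()

allSubsets : ∀ n → List (Subset n)
allSubsets zero = [] ∷ []
allSubsets (suc n) = map (true ∷_) (allSubsets n) ++ map (false ∷_) (allSubsets n)

ep : ∀ {n} (M : Matroid n) → Subset n → ℕ
ep {n} M B = length (filter (ExtPassive? M B) (allFin n))

nbcCount : ∀ {n} (M : Matroid n) → Subset n → ℕ → ℕ
nbcCount {n} M B i =
  length (filter (λ W → (∣ W ∣ Data.Nat.≟ (∣ B ∣ + i)) ×-dec IsNBCOn? M W B) (allSubsets n))
  where import Data.Nat

{-# OPTIONS --safe #-}
-- If B is a basis of M and B ⊆ W, then B is a basis of M|_W, and a circuit inside B ∪ x is a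
-- circuit of M|_W exactly when it is one of M.  So B ∈ NBC(M|_W) iff W = B ∪ S with S a set of
-- externally passive elements, and |W| = |B| + i forces |S| = i.  Counting such W is then a
-- pure subset count, done by induction on n with Pascal's rule.
module Submission where

open import Defs
open import Data.Nat using (ℕ; _+_)
open import Data.Nat.Combinatorics using (_C_)
open import Data.Fin.Subset using (Subset)
open import Relation.Binary.PropositionalEquality using (_≡_)

open import Level using (Level)
open import Data.Nat using (zero; suc; _≤_; _≟_)
open import Data.Nat.Properties using (suc-injective; +-suc; +-identityʳ; 0≢1+n; n≮n)
open import Data.Nat.Combinatorics using (nCk+nC[k+1]≡[n+1]C[k+1])
open import Data.Fin using (Fin; zero; suc)
open import Data.Fin.Subset using (Side; inside; outside; _∈_; _∉_; _⊆_; _∪_; ⁅_⁆; ∣_∣; ⊤)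
open import Data.Fin.Subset.Properties
  using (∈⊤; ⊆-trans; drop-there; drop-∷-⊆; x∈p∪q⁻; x∈⁅y⁆⇒x≡y; p⊆q⇒∣p∣≤∣q∣)
open import Data.Vec using ([]; _∷_; here; there)
open import Data.List using (List; []; _∷_; [_]; map; _++_; length; filter; allFin)
open import Data.List.Properties
  using (filter-++; filter-accept; filter-reject; filter-none; length-++; map-tabulate)
open import Data.List.Relation.Unary.All using (universal)
open import Data.Product using (_×_; _,_; proj₁; proj₂; map₂)
open import Data.Sum using ([_,_]′)
open import Function using (_∘_; id)
open import Relation.Nullary using (¬_; Dec; yes; no; contradiction)
open import Relation.Nullary.Decidable using (_×-dec_)
open import Relation.Unary using (Pred; Decidable; _≐_)
open import Relation.Unary.Properties using (≐-trans)
open import Relation.Binary.PropositionalEquality using (refl; sym; trans; cong; cong₂; subst; module ≡-Reasoning)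

private variable
  a p ℓ : Level
  A A′ : Set a
  n k : ℕ

count : {P : Pred A p} → Decidable P → List A → ℕ
count P? = length ∘ filter P?

module _ {P : Pred A p} (P? : Decidable P) where

  count-++ : ∀ xs ys → count P? (xs ++ ys) ≡ count P? xs + count P? ys
  count-++ xs ys = trans (cong length (filter-++ P? xs ys)) (length-++ (filter P? xs))

  count-map : ∀ (f : A′ → A) xs → count P? (map f xs) ≡ count (P? ∘ f) xs
  count-map f [] = refl
  count-map f (x ∷ xs) with P? (f x)
  ... | yes _ = cong suc (count-map f xs)
  ... | no _ = count-map f xs

  count-none : (∀ x → ¬ P x) → ∀ xs → count P? xs ≡ 0
  count-none ¬P xs = cong length (filter-none P? (universal ¬P xs))

count-allSubsets-suc : {Q : Pred (Subset (suc n)) p} (Q? : Decidable Q) →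
                       count Q? (allSubsets (suc n)) ≡
                       count (Q? ∘ (inside ∷_)) (allSubsets n) + count (Q? ∘ (outside ∷_)) (allSubsets n)
count-allSubsets-suc {n} Q? =
  trans (count-++ Q? (map (inside ∷_) (allSubsets n)) _)
        (cong₂ _+_ (count-map Q? (inside ∷_) (allSubsets n)) (count-map Q? (outside ∷_) (allSubsets n)))

count-allFin-suc : {P : Pred (Fin (suc n)) p} (P? : Decidable P) →
                   count P? (allFin (suc n)) ≡ count P? [ zero ] + count (P? ∘ suc) (allFin n)
count-allFin-suc {n} P? = begin
  count P? (allFin (suc n))                          ≡⟨ cong (count P? ∘ (zero ∷_)) (map-tabulate id suc) ⟨
  count P? ([ zero ] ++ map suc (allFin n))          ≡⟨ count-++ P? [ zero ] _ ⟩
  count P? [ zero ] + count P? (map suc (allFin n))  ≡⟨ cong (count P? [ zero ] +_) (count-map P? suc (allFin n)) ⟩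
  count P? [ zero ] + count (P? ∘ suc) (allFin n)    ∎
  where open ≡-Reasoning

module _ {n} {P : Pred (Fin (suc n)) p} (P? : Decidable P) where

  count-allFin-reject : ¬ P zero → count P? (allFin (suc n)) ≡ count (P? ∘ suc) (allFin n)
  count-allFin-reject ¬P0 =
    trans (count-allFin-suc P?) (cong (_+ count (P? ∘ suc) (allFin n)) (cong length (filter-reject P? ¬P0)))

  count-allFin-accept : P zero → count P? (allFin (suc n)) ≡ suc (count (P? ∘ suc) (allFin n))
  count-allFin-accept P0 =
    trans (count-allFin-suc P?) (cong (_+ count (P? ∘ suc) (allFin n)) (cong length (filter-accept P? P0)))

≐-precompose : {P Q : Pred A ℓ} (f : A′ → A) → P ≐ Q → (P ∘ f) ≐ (Q ∘ f)
≐-precompose f (P⊆Q , Q⊆P) = P⊆Q , Q⊆P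

Between : Subset n → Pred (Fin n) ℓ → Pred (Subset n) ℓ
Between B F W = B ⊆ W × (∀ {x} → x ∈ W → x ∉ B → F x)

Extension : Subset n → Pred (Fin n) ℓ → ℕ → Pred (Subset n) ℓ
Extension B F k W = ∣ W ∣ ≡ ∣ B ∣ + k × Between B F W

module _ {b w : Side} {B W : Subset n} {F : Pred (Fin (suc n)) ℓ} where

  between-tail : Between (b ∷ B) F (w ∷ W) → Between B (F ∘ suc) W
  between-tail (B⊆W , free) = drop-∷-⊆ B⊆W , λ x∈W x∉B → free (there x∈W) (x∉B ∘ drop-there)

  between-∷ : (zero ∈ b ∷ B → zero ∈ w ∷ W) → (zero ∈ w ∷ W → zero ∉ b ∷ B → F zero) →
              Between B (F ∘ suc) W → Between (b ∷ B) F (w ∷ W)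
  between-∷ head⊆ head-free (B⊆W , free) = tail⊆ , tail-free
    where
    tail⊆ : b ∷ B ⊆ w ∷ W
    tail⊆ {zero} = head⊆
    tail⊆ {suc x} x∈B = there (B⊆W (drop-there x∈B))
    tail-free : ∀ {x} → x ∈ w ∷ W → x ∉ b ∷ B → F x
    tail-free {zero} = head-free
    tail-free {suc x} x∈W x∉B = free (drop-there x∈W) (x∉B ∘ there)

module _ {B : Subset n} {F : Pred (Fin (suc n)) ℓ} where

  extension-in∷in : (Extension (inside ∷ B) F k ∘ (inside ∷_)) ≐ Extension B (F ∘ suc) k
  extension-in∷in = (λ (size , between) → suc-injective size , between-tail between)
                  , (λ (size , between) →
                       cong suc size , between-∷ (λ _ → here) (λ _ 0∉B → contradiction here 0∉B) between)

  extension-out∷out : (Extension (outside ∷ B) F k ∘ (outside ∷_)) ≐ Extension B (F ∘ suc) k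
  extension-out∷out = (λ (size , between) → size , between-tail between)
                    , (λ (size , between) → size , between-∷ (λ ()) (λ ()) between)

  extension-out∷in : F zero → (Extension (outside ∷ B) F (suc k) ∘ (inside ∷_)) ≐ Extension B (F ∘ suc) k
  extension-out∷in {k} F0 =
      (λ (size , between) → suc-injective (trans size (+-suc ∣ B ∣ k)) , between-tail between)
    , (λ (size , between) → trans (cong suc size) (sym (+-suc ∣ B ∣ k)) , between-∷ (λ ()) (λ _ _ → F0) between)

  ¬extension-in∷out : ∀ {W} → ¬ Extension (inside ∷ B) F k (outside ∷ W)
  ¬extension-in∷out (_ , B⊆W , _) with B⊆W here
  ... | ()

  ¬extension-out∷in : ∀ {W} → ¬ F zero → ¬ Extension (outside ∷ B) F k (inside ∷ W)
  ¬extension-out∷in ¬F0 (_ , _ , free) = ¬F0 (free here λ ())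

  ¬extension₀-out∷in : ∀ {W} → ¬ Extension (outside ∷ B) F 0 (inside ∷ W)
  ¬extension₀-out∷in {W} (size , between) =
    n≮n ∣ W ∣ (subst (_≤ ∣ W ∣) (trans (sym (+-identityʳ ∣ B ∣)) (sym size))
                                (p⊆q⇒∣p∣≤∣q∣ (proj₁ (between-tail between))))

-- Quantifying over every decider of a predicate equivalent to Extension B F k, rather than
-- fixing one, lets the induction hand Q? ∘ (w ∷_) to the tail unchanged.
ExtensionsCounted : (B : Subset n) {F : Pred (Fin n) ℓ} → Decidable F → Set _
ExtensionsCounted {n} {ℓ} B {F} F? =
  ∀ k {Q : Pred (Subset n) ℓ} (Q? : Decidable Q) → Q ≐ Extension B F k →
  count Q? (allSubsets n) ≡ count F? (allFin n) C k

extensionsCounted-[] : {F : Pred (Fin 0) ℓ} (F? : Decidable F) → ExtensionsCounted [] F?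
extensionsCounted-[] _ zero    Q? Q≐E = cong length (filter-accept Q? (proj₂ Q≐E (refl , (λ ()) , λ ())))
extensionsCounted-[] _ (suc k) Q? Q≐E = cong length (filter-reject Q? (0≢1+n ∘ proj₁ ∘ proj₁ Q≐E))

module _ {B : Subset n} {F : Pred (Fin (suc n)) ℓ} (F? : Decidable F)
         (ih : ExtensionsCounted B (F? ∘ suc)) where

  private
    S = allSubsets n
    c = count (F? ∘ suc) (allFin n)

    ih∷ : ∀ {b w k k′} {Q : Pred (Subset (suc n)) ℓ} (Q? : Decidable Q) → Q ≐ Extension (b ∷ B) F k →
          (Extension (b ∷ B) F k ∘ (w ∷_)) ≐ Extension B (F ∘ suc) k′ →
          count (Q? ∘ (w ∷_)) S ≡ c C k′
    ih∷ Q? Q≐E E≐E′ = ih _ _ (≐-trans (≐-precompose _ Q≐E) E≐E′)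

  open ≡-Reasoning

  extensionsCounted-inside : ¬ F zero → ExtensionsCounted (inside ∷ B) F?
  extensionsCounted-inside ¬F0 k Q? Q≐E = begin
    count Q? (allSubsets (suc n))                             ≡⟨ count-allSubsets-suc Q? ⟩
    count (Q? ∘ (inside ∷_)) S + count (Q? ∘ (outside ∷_)) S  ≡⟨ cong₂ _+_ (ih∷ Q? Q≐E extension-in∷in) absent ⟩
    c C k + 0                                                 ≡⟨ +-identityʳ (c C k) ⟩
    c C k                                                     ≡⟨ cong (_C k) (count-allFin-reject F? ¬F0) ⟨
    count F? (allFin (suc n)) C k                             ∎
    where absent = count-none (Q? ∘ (outside ∷_)) (λ _ → ¬extension-in∷out ∘ proj₁ Q≐E) S

  extensionsCounted-outside : Dec (F zero) → ExtensionsCounted (outside ∷ B) F?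
  extensionsCounted-outside (no ¬F0) k Q? Q≐E = begin
    count Q? (allSubsets (suc n))                             ≡⟨ count-allSubsets-suc Q? ⟩
    count (Q? ∘ (inside ∷_)) S + count (Q? ∘ (outside ∷_)) S  ≡⟨ cong₂ _+_ absent (ih∷ Q? Q≐E extension-out∷out) ⟩
    c C k                                                     ≡⟨ cong (_C k) (count-allFin-reject F? ¬F0) ⟨
    count F? (allFin (suc n)) C k                             ∎
    where absent = count-none (Q? ∘ (inside ∷_)) (λ _ → ¬extension-out∷in ¬F0 ∘ proj₁ Q≐E) S

  extensionsCounted-outside (yes F0) zero Q? Q≐E = begin
    count Q? (allSubsets (suc n))                             ≡⟨ count-allSubsets-suc Q? ⟩
    count (Q? ∘ (inside ∷_)) S + count (Q? ∘ (outside ∷_)) S  ≡⟨ cong₂ _+_ absent (ih∷ Q? Q≐E extension-out∷out) ⟩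
    1                                                         ≡⟨⟩
    count F? (allFin (suc n)) C 0                             ∎
    where absent = count-none (Q? ∘ (inside ∷_)) (λ _ → ¬extension₀-out∷in ∘ proj₁ Q≐E) S
  extensionsCounted-outside (yes F0) (suc k) Q? Q≐E = begin
    count Q? (allSubsets (suc n))                             ≡⟨ count-allSubsets-suc Q? ⟩
    count (Q? ∘ (inside ∷_)) S + count (Q? ∘ (outside ∷_)) S  ≡⟨ cong₂ _+_ (ih∷ Q? Q≐E (extension-out∷in F0))
                                                                             (ih∷ Q? Q≐E extension-out∷out) ⟩
    c C k + c C suc k                                         ≡⟨ nCk+nC[k+1]≡[n+1]C[k+1] c k ⟩
    suc c C suc k                                             ≡⟨ cong (_C suc k) (count-allFin-accept F? F0) ⟨
    count F? (allFin (suc n)) C suc k                         ∎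

disjoint-tail : ∀ {b} {B : Subset n} {F : Pred (Fin (suc n)) ℓ} →
                (∀ {x} → F x → x ∉ b ∷ B) → (∀ {x} → F (suc x) → x ∉ B)
disjoint-tail F∩B=∅ F[sx] x∈B = F∩B=∅ F[sx] (there x∈B)

extensionsCounted : (B : Subset n) {F : Pred (Fin n) ℓ} (F? : Decidable F) →
                    (∀ {x} → F x → x ∉ B) → ExtensionsCounted B F?
extensionsCounted [] F? _ = extensionsCounted-[] F?
extensionsCounted (inside ∷ B) F? F∩B=∅ =
  extensionsCounted-inside F? (extensionsCounted B (F? ∘ suc) (disjoint-tail F∩B=∅)) (λ F0 → F∩B=∅ F0 here)
extensionsCounted (outside ∷ B) F? F∩B=∅ =
  extensionsCounted-outside F? (extensionsCounted B (F? ∘ suc) (disjoint-tail F∩B=∅)) (F? zero)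

∪⁅⁆-⊆ : ∀ {B W : Subset n} {x} → B ⊆ W → x ∈ W → B ∪ ⁅ x ⁆ ⊆ W
∪⁅⁆-⊆ {B = B} {W} {x} B⊆W x∈W y∈B∪x =
  [ B⊆W , (λ y∈⁅x⁆ → subst (_∈ W) (sym (x∈⁅y⁆⇒x≡y x y∈⁅x⁆)) x∈W) ]′ (x∈p∪q⁻ B ⁅ x ⁆ y∈B∪x)

module _ (M : Matroid n) where

  circuitOn⇒circuit : ∀ {E C} → IsCircuitOn M E C → IsCircuitOn M ⊤ C
  circuitOn⇒circuit (C⊆E , dependent , minimal) =
    (λ _ → ∈⊤) , (λ (_ , indep) → dependent (C⊆E , indep)) ,
    (λ D D⊂C → (λ _ → ∈⊤) , proj₂ (minimal D D⊂C))

  circuit⇒circuitOn : ∀ {E C} → C ⊆ E → IsCircuitOn M ⊤ C → IsCircuitOn M E C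
  circuit⇒circuitOn C⊆E (_ , dependent , minimal) =
    C⊆E , (λ (_ , indep) → dependent ((λ _ → ∈⊤) , indep)) ,
    (λ D D⊂C → ⊆-trans (proj₁ D⊂C) C⊆E , proj₂ (minimal D D⊂C))

  minOfCircuitOn⇒minOfCircuit : ∀ {E B x} → IsMinOfCircuitOn M E B x → IsMinOfCircuitOn M ⊤ B x
  minOfCircuitOn⇒minOfCircuit (C , circuit , rest) = C , circuitOn⇒circuit circuit , rest

  minOfCircuit⇒minOfCircuitOn : ∀ {E B x} → B ∪ ⁅ x ⁆ ⊆ E →
                                IsMinOfCircuitOn M ⊤ B x → IsMinOfCircuitOn M E B x
  minOfCircuit⇒minOfCircuitOn B∪x⊆E (C , circuit , C⊆B∪x , rest) =
    C , circuit⇒circuitOn (⊆-trans C⊆B∪x B∪x⊆E) circuit , C⊆B∪x , rest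

  basis⇒basisOn : ∀ {E B} → IsBasis M B → B ⊆ E → IsBasisOn M E B
  basis⇒basisOn ((_ , indep) , maximal) B⊆E =
    (B⊆E , indep) , λ B′ B⊆B′ (_ , indep′) → maximal B′ B⊆B′ ((λ _ → ∈⊤) , indep′)

  nbcOn≐between : ∀ {B} → IsBasis M B → (λ W → IsNBCOn M W B) ≐ Between B (ExtPassive M B)
  nbcOn≐between {B} basis = nbc⇒between , between⇒nbc
    where
    nbc⇒between : ∀ {W} → IsNBCOn M W B → Between B (ExtPassive M B) W
    nbc⇒between (((B⊆W , _) , _) , noBrokenCircuit) =
      B⊆W , λ x∈W x∉B → x∉B , noBrokenCircuit _ x∈W x∉B ∘ minOfCircuit⇒minOfCircuitOn (∪⁅⁆-⊆ B⊆W x∈W)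
    between⇒nbc : ∀ {W} → Between B (ExtPassive M B) W → IsNBCOn M W B
    between⇒nbc (B⊆W , passive) =
      basis⇒basisOn basis B⊆W , λ _ x∈W x∉B → proj₂ (passive x∈W x∉B) ∘ minOfCircuitOn⇒minOfCircuit

lemma2p3 : ∀ {n} (M : Matroid n) → Loopless M → (B : Subset n) → IsBasis M B →
           (i : ℕ) → ep M B C i ≡ nbcCount M B i
lemma2p3 M _ B basis i =
  sym (extensionsCounted B (ExtPassive? M B) proj₁ i
         (λ W → (∣ W ∣ ≟ ∣ B ∣ + i) ×-dec IsNBCOn? M W B)
         (map₂ (proj₁ (nbcOn≐between M basis)) , map₂ (proj₂ (nbcOn≐between M basis))))
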